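{- Let $\lambda$ be a shape with set of segments $S$. Let $\Theta$ be the equivalence relation on $\mathrm{Bic}(S)$ given by $X\equiv Y \pmod\Theta$ if and only if $X^{\downarrow}=Y^{\downarrow}$. Then $\Theta$ is a lattice congruence on the lattice $\mathrm{Bic}(S)$.
   Context: A shape is a finite induced subgraph $\lambda$ of the square grid graph on $\mathbb{Z}\times\mathbb{Z}$; North means increasing second coordinate, East increasing first coordinate. A vertex $v$ of $\lambda$ is interior if all nine points $v+(a,b)$, $a,b\in\{ -1,0,1\}$, are vertices of $\lambda$. A segment of $\lambda$ is a sequence $u_0,\dots,u_m$ ($m\ge0$) of interior vertices with each $u_i$ one step South or East of $u_{i-1}$; $s_{\mathrm{init}}=u_0$, $s_{\mathrm{term}}=u_m$. Segments $s,t$ are composable if $s_{\mathrm{term}}$ is one unit North or West of $t_{\mathrm{init}}$, and then $s\circ t$ is the concatenation. A set $X$ of segments is closed if $s,t\in X$ composable implies $s\circ t\in X$, and biclosed if $X$ and $S\setminus X$ are both closed; $\mathrm{Bic}(S)$, the set of biclosed sets ordered by inclusion, is a finite lattice. For a segment $s=(u_0,\dots,u_m)$ and $0\le a\le b\le m$, the subsegment $(u_a,\dots,u_b)$ is a SW-subsegment of $s$ if ($a=0$ or $u_{a-1}$ is one step North of $u_a$) and ($b=m$ or $u_{b+1}$ is one step East of $u_b$). For $X\in\mathrm{Bic}(S)$, $X^{\downarrow}$ is the set of segments $s\in X$ such that every SW-subsegment of $s$ lies in $X$. A lattice congruence is an equivalence relation $\Theta$ such that $x\equiv y$ implies $x\vee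 z\equiv y\vee z$ and $x\wedge z\equiv y\wedge z$. -}

module Defs where

open import Data.Bool using (Bool; true; false; T; not; _∧_)
open import Data.Integer using (ℤ; _+_; _-_; +_)
import Data.Integer as ℤ
open import Data.List using (List; []; _∷_; _++_)
open import Data.Bool.ListAction using (any; all)
open import Data.Unit using (⊤)
open import Data.Product using (_×_; _,_; Σ; ∃; ∃-syntax; proj₁; proj₂)
open import Data.Product.Properties using (≡-dec)
open import Data.Sum using (_⊎_)
open import Relation.Binary.PropositionalEquality using (_≡_)
open import Relation.Nullary.Decidable using (⌊_⌋)

-- Points of ℤ × ℤ : first coordinate = East, second = North.
Point : Set
Point = ℤ × ℤ

_≟ₚ_ : (p q : Point) → Relation.Nullary.Decidable.Dec (p ≡ q)
_≟ₚ_ = ≡-dec ℤ._≟_ ℤ._≟_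

-- A shape: a finite induced subgraph of the grid; it is determined by its
-- finite vertex set, given as a list (duplicates harmless).
Shape : Set
Shape = List Point

inShape : Shape → Point → Bool
inShape λ' p = any (λ q → ⌊ p ≟ₚ q ⌋) λ'

offsets : List Point
offsets = ((ℤ.- + 1) , (ℤ.- + 1)) ∷ ((ℤ.- + 1) , + 0) ∷ ((ℤ.- + 1) , + 1)
        ∷ (+ 0 , (ℤ.- + 1)) ∷ (+ 0 , + 0) ∷ (+ 0 , + 1)
        ∷ (+ 1 , (ℤ.- + 1)) ∷ (+ 1 , + 0) ∷ (+ 1 , + 1) ∷ []

interior : Shape → Point → Bool
interior λ' (x , y) = all (λ { (a , b) → inShape λ' (x + a , y + b) }) offsets

data Dir : Set where
  S E : Dir

step : Dir → Point → Point
step S (x , y) = (x , y - + 1)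
step E (x , y) = (x + + 1 , y)

record Seg : Set where
  constructor seg
  field
    init  : Point
    steps : List Dir
open Seg public

walk : Point → List Dir → Point
walk p []       = p
walk p (d ∷ ds) = walk (step d p) ds

term : Seg → Point
term s = walk (init s) (steps s)

vertices : Point → List Dir → List Point
vertices p []       = p ∷ []
vertices p (d ∷ ds) = p ∷ vertices (step d p) ds

IsSeg : Shape → Seg → Set
IsSeg λ' s = T (all (interior λ') (vertices (init s) (steps s)))

-- s, t composable: s_term is one unit North or West of t_init, i.e.
-- t_init = step d s_term for d = S (resp. E); composite inserts that step.
Composable : Seg → Seg → Dir → Set
Composable s t d = step d (term s) ≡ init t

compose : Seg → Seg → Dir → Seg
compose s t d = seg (init s) (steps s ++ (d ∷ steps t))

-- Subsets of the set of segments, as Boolean predicates (only their values on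
-- segments of λ matter).
SegSet : Set
SegSet = Seg → Bool

compl : SegSet → SegSet
compl X s = not (X s)

Closed : Shape → SegSet → Set
Closed λ' X = ∀ s t d → IsSeg λ' s → IsSeg λ' t → Composable s t d →
              T (X s) → T (X t) → T (X (compose s t d))

Biclosed : Shape → SegSet → Set
Biclosed λ' X = Closed λ' X × Closed λ' (compl X)

_⊆[_]_ : SegSet → Shape → SegSet → Set
X ⊆[ λ' ] Y = ∀ s → IsSeg λ' s → T (X s) → T (Y s)

_≈[_]_ : SegSet → Shape → SegSet → Set
X ≈[ λ' ] Y = X ⊆[ λ' ] Y × Y ⊆[ λ' ] X

IsJoin : Shape → SegSet → SegSet → SegSet → Set
IsJoin λ' X Y J = Biclosed λ' J × X ⊆[ λ' ] J × Y ⊆[ λ' ] J ×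
  (∀ K → Biclosed λ' K → X ⊆[ λ' ] K → Y ⊆[ λ' ] K → J ⊆[ λ' ] K)

IsMeet : Shape → SegSet → SegSet → SegSet → Set
IsMeet λ' X Y M = Biclosed λ' M × M ⊆[ λ' ] X × M ⊆[ λ' ] Y ×
  (∀ K → Biclosed λ' K → K ⊆[ λ' ] X → K ⊆[ λ' ] Y → K ⊆[ λ' ] M)

lastIsS : List Dir → Set
lastIsS []           = ⊤
lastIsS (d ∷ [])     = d ≡ S
lastIsS (_ ∷ d ∷ ds) = lastIsS (d ∷ ds)

headIsE : List Dir → Set
headIsE []      = ⊤
headIsE (d ∷ _) = d ≡ E

-- t is a SW-subsegment of s = (u₀,…,u_m): steps s = pre ++ mid ++ post with
-- a = length pre, b = a + length mid; (a = 0 or u_{a-1} one step North of u_a,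
-- i.e. last pre = S) and (b = m or u_{b+1} one step East of u_b, i.e. head post = E).
SWSub : Seg → Seg → Set
SWSub t s = ∃[ pre ] ∃[ mid ] ∃[ post ]
  (steps s ≡ pre ++ mid ++ post) × lastIsS pre × headIsE post ×
  (t ≡ seg (walk (init s) pre) mid)

InDown : Shape → SegSet → Seg → Set
InDown λ' X s = T (X s) × (∀ t → SWSub t s → T (X t))

DownEq : Shape → SegSet → SegSet → Set
DownEq λ' X Y = ∀ s → IsSeg λ' s →
  (InDown λ' X s → InDown λ' Y s) × (InDown λ' Y s → InDown λ' X s)

IsLatticeCongruence : Shape → (SegSet → SegSet → Set) → Set
IsLatticeCongruence λ' R =
  (∀ X → Biclosed λ' X → R X X) ×
  (∀ X Y → Biclosed λ' X → Biclosed λ' Y → R X Y → R Y X) ×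
  (∀ X Y Z → Biclosed λ' X → Biclosed λ' Y → Biclosed λ' Z →
     R X Y → R Y Z → R X Z) ×
  (∀ X Y Z J₁ J₂ → Biclosed λ' X → Biclosed λ' Y → Biclosed λ' Z →
     R X Y → IsJoin λ' X Z J₁ → IsJoin λ' Y Z J₂ → R J₁ J₂) ×
  (∀ X Y Z M₁ M₂ → Biclosed λ' X → Biclosed λ' Y → Biclosed λ' Z →
     R X Y → IsMeet λ' X Z M₁ → IsMeet λ' Y Z M₂ → R M₁ M₂)

module Submission where

-- An (x,y)-subsegment of s is a piece s[pre|mid|post] with pre empty or ending
-- in an x-step and post empty or starting with a y-step; the SW-subsegments are
-- the (S,E)-subsegments.  Down x y X, the (decidable) set of segments whose
-- (x,y)-subsegments all lie in X, generalises X↓ = Down S E X.  We show: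
--  * for x ≠ y and X closed, Down x y X is biclosed (a subsegment of p ∘ q lies
--    in p, in q, or straddles the joint);
--  * descent: if the complement of A is closed, each s ∈ A has a
--    (y,x)-subsegment in Down x y A (cut s along a subsegment outside A and
--    recurse on the length).
-- Meets: M₁↓ is biclosed and below Y and Z, so below M₂ = Y ∧ Z; thus M₁↓ ⊆ M₂↓.
-- Joins: the segments with an (E,S)-subsegment in J₂ = Y ∨ Z form a biclosed set
-- containing X (by descent) and Z, hence J₁ = X ∨ Z; by descent again, no
-- SW-subsegment of an element of J₁↓ lies outside J₂.

open import Defs
open import Data.Bool using (true; false; T; not)
open import Data.Bool.Properties using (T-∧)
open import Data.Empty using (⊥; ⊥-elim)
open import Data.List using (List; []; _∷_; _++_; [_]; _∷ʳ_; length; initLast; _∷ʳ′_)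
open import Data.List.Properties
  using (++-assoc; ++-identityʳ; ∷-injectiveˡ; ∷-injectiveʳ; length-++-sucʳ; length-++-≤ˡ; length-++-≤ʳ)
open import Data.Nat using (_<_; s≤s)
open import Data.Nat.Induction using (<-wellFounded)
open import Data.Product using (_×_; _,_; proj₁; proj₂; ∃₂; ∃-syntax; swap)
open import Data.Sum using (_⊎_; inj₁; inj₂)
open import Data.Unit using (⊤; tt)
open import Function using (_∘_; id)
open import Function.Bundles using (Equivalence)
open import Induction.WellFounded using (Acc; acc)
open import Relation.Binary.PropositionalEquality using (_≡_; refl; sym; trans; cong; subst; module ≡-Reasoning)
open import Relation.Nullary using (¬_; Dec; yes; no)
open import Relation.Nullary.Decidable
  using (⌊_⌋; map′; ¬?; _×-dec_; T?; toWitness; fromWitness)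

T-not→¬ : ∀ {b} → T (not b) → ¬ T b
T-not→¬ {true}  ()
T-not→¬ {false} _ ()

¬→T-not : ∀ {b} → ¬ T b → T (not b)
¬→T-not {true}  ¬b = ¬b tt
¬→T-not {false} _  = tt

biclosed-compl : ∀ {λ' X} → Biclosed λ' X → Biclosed λ' (compl X)
biclosed-compl {λ'} {X} (closedX , closedXᶜ) = closedXᶜ , closedXᶜᶜ
  where
  ¬¬-intro : ∀ {b} → T b → T (not (not b))
  ¬¬-intro {true} _ = tt

  ¬¬-elim : ∀ {b} → T (not (not b)) → T b
  ¬¬-elim {true} _ = tt

  closedXᶜᶜ : Closed λ' (compl (compl X))
  closedXᶜᶜ s t d hs ht st xs xt = ¬¬-intro (closedX s t d hs ht st (¬¬-elim xs) (¬¬-elim xt))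

_≟ᵈ_ : (c d : Dir) → Dec (c ≡ d)
S ≟ᵈ S = yes refl
E ≟ᵈ E = yes refl
S ≟ᵈ E = no λ ()
E ≟ᵈ S = no λ ()

dir-cases : ∀ {x y : Dir} → ¬ x ≡ y → ∀ d → d ≡ x ⊎ d ≡ y
dir-cases {S} {S} x≢y _ = ⊥-elim (x≢y refl)
dir-cases {E} {E} x≢y _ = ⊥-elim (x≢y refl)
dir-cases {S} {E} _   S = inj₁ refl
dir-cases {S} {E} _   E = inj₂ refl
dir-cases {E} {S} _   S = inj₂ refl
dir-cases {E} {S} _   E = inj₁ refl

LastIs : Dir → List Dir → Set
LastIs x []           = ⊤
LastIs x (d ∷ [])     = d ≡ x
LastIs x (_ ∷ d ∷ ds) = LastIs x (d ∷ ds)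

HeadIs : Dir → List Dir → Set
HeadIs y []      = ⊤
HeadIs y (d ∷ _) = d ≡ y

lastIs? : ∀ x ds → Dec (LastIs x ds)
lastIs? x []           = yes tt
lastIs? x (d ∷ [])     = d ≟ᵈ x
lastIs? x (_ ∷ d ∷ ds) = lastIs? x (d ∷ ds)

headIs? : ∀ y ds → Dec (HeadIs y ds)
headIs? y []      = yes tt
headIs? y (d ∷ _) = d ≟ᵈ y

lastIsS≡LastIs : ∀ ds → lastIsS ds ≡ LastIs S ds
lastIsS≡LastIs []           = refl
lastIsS≡LastIs (d ∷ [])     = refl
lastIsS≡LastIs (_ ∷ d ∷ ds) = lastIsS≡LastIs (d ∷ ds)

headIsE≡HeadIs : ∀ ds → headIsE ds ≡ HeadIs E ds
headIsE≡HeadIs []      = refl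
headIsE≡HeadIs (d ∷ _) = refl

last-++ʳ : ∀ {x} a c ds → LastIs x (c ∷ ds) → LastIs x (a ++ c ∷ ds)
last-++ʳ []          c ds h = h
last-++ʳ (_ ∷ [])    c ds h = h
last-++ʳ (_ ∷ e ∷ a) c ds h = last-++ʳ (e ∷ a) c ds h

last-++ : ∀ {x} a b → LastIs x a → LastIs x b → LastIs x (a ++ b)
last-++ a []      ha _  = subst (LastIs _) (sym (++-identityʳ a)) ha
last-++ a (c ∷ b) _  hb = last-++ʳ a c b hb

last-cons : ∀ {x d} ds → d ≡ x → LastIs x ds → LastIs x (d ∷ ds)
last-cons []      d≡x _ = d≡x
last-cons (_ ∷ _) _   h = h

last-tail : ∀ {x} d ds → LastIs x (d ∷ ds) → LastIs x ds
last-tail d []      _ = tt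
last-tail d (_ ∷ _) h = h

last-suffix : ∀ {x} a b → LastIs x (a ++ b) → LastIs x b
last-suffix []      b h = h
last-suffix (d ∷ a) b h = last-suffix a b (last-tail d (a ++ b) h)

last-snoc : ∀ {x} a c → LastIs x (a ∷ʳ c) → c ≡ x
last-snoc a c = last-suffix a [ c ]

head-++ : ∀ {y} a b → HeadIs y a → HeadIs y b → HeadIs y (a ++ b)
head-++ []      b _  hb = hb
head-++ (_ ∷ _) b ha _  = ha

head-prefix : ∀ {y} a b → HeadIs y (a ++ b) → HeadIs y a
head-prefix []      b _ = tt
head-prefix (_ ∷ _) b h = h

++-split : ∀ {A : Set} (a : List A) d b c e → a ++ d ∷ b ≡ c ++ e →
  (∃[ r ] c ≡ a ++ d ∷ r × b ≡ r ++ e) ⊎ (∃[ r ] a ≡ c ++ r × e ≡ r ++ d ∷ b)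
++-split a        d b []       e eq = inj₂ (a , refl , sym eq)
++-split []       d b (c ∷ cs) e eq with ∷-injectiveˡ eq | ∷-injectiveʳ eq
... | refl | refl = inj₁ (cs , refl , refl)
++-split (a ∷ as) d b (c ∷ cs) e eq with ∷-injectiveˡ eq | ++-split as d b cs e (∷-injectiveʳ eq)
... | refl | inj₁ (r , c≡ , b≡) = inj₁ (r , cong (a ∷_) c≡ , b≡)
... | refl | inj₂ (r , a≡ , e≡) = inj₂ (r , cong (a ∷_) a≡ , e≡)

any-split? : ∀ {A : Set} {P : List A → List A → Set} → (∀ a b → Dec (P a b)) →
  ∀ l → Dec (∃₂ λ a b → l ≡ a ++ b × P a b)
any-split? P? [] = map′ (λ h → [] , [] , refl , h) (λ { ([] , [] , refl , h) → h }) (P? [] [])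
any-split? {P = P} P? (c ∷ l) with P? [] (c ∷ l) | any-split? (λ a b → P? (c ∷ a) b) l
... | yes h  | _                     = yes ([] , c ∷ l , refl , h)
... | no _   | yes (a , b , refl , h) = yes (c ∷ a , b , refl , h)
... | no ¬h  | no ¬r                 = no none
  where
  none : ¬ ∃₂ λ a b → c ∷ l ≡ a ++ b × P a b
  none ([]    , _ , refl , h) = ¬h h
  none (_ ∷ a , b , refl , h) = ¬r (a , b , refl , h)

shorter-prefix : ∀ {A : Set} {ds : List A} a c b → ds ≡ a ++ c ∷ b → length a < length ds
shorter-prefix a c b refl rewrite length-++-sucʳ a c b = s≤s (length-++-≤ˡ a)

shorter-suffix : ∀ {A : Set} {ds : List A} a c b → ds ≡ a ++ c ∷ b → length b < length ds
shorter-suffix a c b refl rewrite length-++-sucʳ a c b = s≤s (length-++-≤ʳ b {a})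

walk-++ : ∀ p a b → walk p (a ++ b) ≡ walk (walk p a) b
walk-++ p []      b = refl
walk-++ p (d ∷ a) b = walk-++ (step d p) a b

record Sub (x y : Dir) (t s : Seg) : Set where
  constructor sub
  field
    pre mid post : List Dir
    cut     : steps s ≡ pre ++ mid ++ post
    before  : LastIs x pre
    after   : HeadIs y post
    located : t ≡ seg (walk (init s) pre) mid

sw→sub : ∀ {t s} → SWSub t s → Sub S E t s
sw→sub (pre , mid , post , cut , l , h , located) =
  sub pre mid post cut (subst id (lastIsS≡LastIs pre) l) (subst id (headIsE≡HeadIs post) h) located

sub→sw : ∀ {t s} → Sub S E t s → SWSub t s
sub→sw (sub pre mid post cut l h located) =
  pre , mid , post , cut , subst id (sym (lastIsS≡LastIs pre)) l , subst id (sym (headIsE≡HeadIs post)) h , located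

sub-refl : ∀ {x y s} → Sub x y s s
sub-refl {s = s} = sub [] (steps s) [] (sym (++-identityʳ (steps s))) tt tt refl

sub-trans : ∀ {x y s t u} → Sub x y t s → Sub x y u t → Sub x y u s
sub-trans {s = s} (sub pre mid post cut l h refl) (sub pre₂ mid₂ post₂ cut₂ l₂ h₂ refl) =
  sub (pre ++ pre₂) mid₂ (post₂ ++ post) regroup (last-++ pre pre₂ l l₂) (head-++ post₂ post h₂ h)
      (cong (λ p → seg p mid₂) (sym (walk-++ (init s) pre pre₂)))
  where
  open ≡-Reasoning
  regroup : steps s ≡ (pre ++ pre₂) ++ mid₂ ++ post₂ ++ post
  regroup = begin
    steps s                                  ≡⟨ cut ⟩
    pre ++ mid ++ post                       ≡⟨ cong (λ m → pre ++ m ++ post) cut₂ ⟩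
    pre ++ (pre₂ ++ mid₂ ++ post₂) ++ post   ≡⟨ cong (pre ++_) (++-assoc pre₂ (mid₂ ++ post₂) post) ⟩
    pre ++ pre₂ ++ (mid₂ ++ post₂) ++ post   ≡⟨ cong (λ m → pre ++ pre₂ ++ m) (++-assoc mid₂ post₂ post) ⟩
    pre ++ pre₂ ++ mid₂ ++ post₂ ++ post     ≡⟨ ++-assoc pre pre₂ (mid₂ ++ post₂ ++ post) ⟨
    (pre ++ pre₂) ++ mid₂ ++ post₂ ++ post   ∎

prefix-sub : ∀ {x y p ds} a b → ds ≡ a ++ y ∷ b → Sub x y (seg p a) (seg p ds)
prefix-sub a b cut = sub [] a (_ ∷ b) cut tt refl refl

suffix-sub : ∀ {x y p ds} a b → ds ≡ a ++ x ∷ b → Sub x y (seg (step x (walk p a)) b) (seg p ds)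
suffix-sub {x} {p = p} a b cut =
  sub (a ∷ʳ x) b [] (trans cut (trans (sym (++-assoc a [ x ] b)) (cong ((a ∷ʳ x) ++_) (sym (++-identityʳ b)))))
      (last-++ʳ a x [] refl) tt (cong (λ q → seg q b) (sym (walk-++ p a [ x ])))

sub-left : ∀ {x y p q d t} → d ≡ y → Sub x y t p → Sub x y t (compose p q d)
sub-left {p = p} {q} {d} refl (sub pre mid post cut l h located) =
  sub pre mid (post ++ d ∷ steps q) cut′ l (head-++ post (d ∷ steps q) h refl) located
  where
  cut′ : steps p ++ d ∷ steps q ≡ pre ++ mid ++ post ++ d ∷ steps q
  cut′ = trans (cong (_++ d ∷ steps q) cut)
               (trans (++-assoc pre (mid ++ post) _) (cong (pre ++_) (++-assoc mid post _)))

sub-right : ∀ {x y p q d t} → Composable p q d → d ≡ x → Sub x y t q → Sub x y t (compose p q d)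
sub-right {p = p} {q} {d} joint refl (sub pre mid post cut l h refl) =
  sub (steps p ++ d ∷ pre) mid post cut′ (last-++ʳ (steps p) d pre (last-cons pre refl l)) h
      (cong (λ z → seg z mid) (sym (trans (walk-++ (init p) (steps p) (d ∷ pre)) (cong (λ z → walk z pre) joint))))
  where
  cut′ : steps p ++ d ∷ steps q ≡ (steps p ++ d ∷ pre) ++ mid ++ post
  cut′ = trans (cong (λ z → steps p ++ d ∷ z) cut) (sym (++-assoc (steps p) (d ∷ pre) (mid ++ post)))

data SubOfComposite (x y : Dir) (p q : Seg) (d : Dir) (t : Seg) : Set where
  inLeft  : Sub x y t p → SubOfComposite x y p q d t
  inRight : Sub x y t q → SubOfComposite x y p q d t
  across  : ∀ {t₁ t₂} → Sub x y t₁ p → Sub x y t₂ q → Composable t₁ t₂ d → t ≡ compose t₁ t₂ d →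
            SubOfComposite x y p q d t

sub-of-composite : ∀ {x y p q d t} → Composable p q d → Sub x y t (compose p q d) → SubOfComposite x y p q d t
sub-of-composite {_} {y} {p} {q} {d} joint (sub pre mid post cut l h refl)
  with ++-split (steps p) d (steps q) pre (mid ++ post) cut
... | inj₁ (r , refl , q≡) =
  inRight (sub r mid post q≡ (last-tail d r (last-suffix (steps p) (d ∷ r) l)) h
    (cong (λ z → seg z mid) (trans (walk-++ (init p) (steps p) (d ∷ r)) (cong (λ z → walk z r) joint))))
... | inj₂ (r , p≡ , rest≡) with ++-split r d (steps q) mid post (sym rest≡)
...   | inj₁ (r₂ , refl , q≡) =
  across (sub pre r [] (trans p≡ (cong (pre ++_) (sym (++-identityʳ r)))) l tt refl)
         (sub [] r₂ post q≡ tt h refl)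
         (trans (cong (step d) (sym (trans (cong (walk (init p)) p≡) (walk-++ (init p) pre r)))) joint)
         refl
...   | inj₂ (r₂ , refl , post≡) =
  inLeft (sub pre mid r₂ p≡ l (head-prefix r₂ (d ∷ steps q) (subst (HeadIs y) post≡ h)) refl)

Down : Dir → Dir → SegSet → Seg → Set
Down x y X s = ∀ t → Sub x y t s → T (X t)

Bad : Dir → Dir → SegSet → Seg → Set
Bad x y X s = ∃[ t ] Sub x y t s × ¬ T (X t)

bad? : ∀ x y X s → Dec (Bad x y X s)
bad? x y X s = map′ toBad fromBad (any-split? (λ pre rest → any-split? (λ mid post → badCut? pre mid post) rest) (steps s))
  where
  BadCut : List Dir → List Dir → List Dir → Set
  BadCut pre mid post = LastIs x pre × HeadIs y post × ¬ T (X (seg (walk (init s) pre) mid))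

  badCut? : ∀ pre mid post → Dec (BadCut pre mid post)
  badCut? pre mid post = lastIs? x pre ×-dec headIs? y post ×-dec ¬? (T? (X (seg (walk (init s) pre) mid)))

  toBad : (∃₂ λ pre rest → steps s ≡ pre ++ rest × ∃₂ λ mid post → rest ≡ mid ++ post × BadCut pre mid post) →
          Bad x y X s
  toBad (pre , _ , cut , mid , post , refl , l , h , ¬t) = _ , sub pre mid post cut l h refl , ¬t

  fromBad : Bad x y X s →
            ∃₂ λ pre rest → steps s ≡ pre ++ rest × ∃₂ λ mid post → rest ≡ mid ++ post × BadCut pre mid post
  fromBad (_ , sub pre mid post cut l h refl , ¬t) = pre , mid ++ post , cut , mid , post , refl , l , h , ¬t

¬bad→Down : ∀ {x y X s} → ¬ Bad x y X s → Down x y X s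
¬bad→Down {X = X} ¬bad t st with T? (X t)
... | yes t∈X = t∈X
... | no t∉X  = ⊥-elim (¬bad (t , st , t∉X))

down? : ∀ x y X s → Dec (Down x y X s)
down? x y X s = map′ ¬bad→Down (λ D (t , st , t∉X) → t∉X (D t st)) (¬? (bad? x y X s))

down : Dir → Dir → SegSet → SegSet
down x y X s = ⌊ down? x y X s ⌋

down→Down : ∀ {x y X s} → T (down x y X s) → Down x y X s
down→Down {x} {y} {X} {s} = toWitness {a? = down? x y X s}

Down→down : ∀ {x y X s} → Down x y X s → T (down x y X s)
Down→down {x} {y} {X} {s} = fromWitness {a? = down? x y X s}

down-hereditary : ∀ {x y X s t} → Down x y X s → Sub x y t s → Down x y X t
down-hereditary D st u tu = D u (sub-trans st tu)

module _ (λ' : Shape) where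

  isSeg-head : ∀ p ds → IsSeg λ' (seg p ds) → T (interior λ' p)
  isSeg-head p []      h = proj₁ (Equivalence.to (T-∧ {interior λ' p}) h)
  isSeg-head p (_ ∷ _) h = proj₁ (Equivalence.to (T-∧ {interior λ' p}) h)

  isSeg-tail : ∀ p d ds → IsSeg λ' (seg p (d ∷ ds)) → IsSeg λ' (seg (step d p) ds)
  isSeg-tail p d ds h = proj₂ (Equivalence.to (T-∧ {interior λ' p}) h)

  isSeg-prefix : ∀ p {ds} a b → ds ≡ a ++ b → IsSeg λ' (seg p ds) → IsSeg λ' (seg p a)
  isSeg-prefix p []      b refl h = Equivalence.from T-∧ (isSeg-head p b h , tt)
  isSeg-prefix p (d ∷ a) b refl h =
    Equivalence.from T-∧ (isSeg-head p (d ∷ a ++ b) h , isSeg-prefix (step d p) a b refl (isSeg-tail p d (a ++ b) h))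

  isSeg-suffix : ∀ p {ds} a b → ds ≡ a ++ b → IsSeg λ' (seg p ds) → IsSeg λ' (seg (walk p a) b)
  isSeg-suffix p []      b refl h = h
  isSeg-suffix p (d ∷ a) b refl h = isSeg-suffix (step d p) a b refl (isSeg-tail p d (a ++ b) h)

  sub-seg : ∀ {x y s t} → IsSeg λ' s → Sub x y t s → IsSeg λ' t
  sub-seg {s = s} hs (sub pre mid post cut _ _ refl) =
    isSeg-prefix (walk (init s) pre) mid post refl (isSeg-suffix (init s) pre (mid ++ post) cut hs)

  co-split : ∀ {A p ds} → Closed λ' (compl A) → ∀ a d b → ds ≡ a ++ d ∷ b →
    IsSeg λ' (seg p ds) → T (A (seg p ds)) → T (A (seg p a)) ⊎ T (A (seg (step d (walk p a)) b))
  co-split {A} {p} closedAᶜ a d b refl h s∈A with T? (A (seg p a)) | T? (A (seg (step d (walk p a)) b))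
  ... | yes l | _     = inj₁ l
  ... | no _  | yes r = inj₂ r
  ... | no ¬l | no ¬r =
    ⊥-elim (T-not→¬ (closedAᶜ _ _ d (isSeg-prefix p a (d ∷ b) refl h)
                                     (isSeg-tail (walk p a) d b (isSeg-suffix p a (d ∷ b) refl h))
                                     refl (¬→T-not ¬l) (¬→T-not ¬r)) s∈A)

  inDown→Down : ∀ {X s} → InDown λ' X s → Down S E X s
  inDown→Down (_ , sw-in-X) t st = sw-in-X t (sub→sw st)

  Down→inDown : ∀ {X s} → Down S E X s → InDown λ' X s
  Down→inDown D = D _ sub-refl , λ t sw → D t (sw→sub sw)

  down-mono : ∀ {x y X Y s} → X ⊆[ λ' ] Y → IsSeg λ' s → Down x y X s → Down x y Y s
  down-mono X⊆Y hs D t st = X⊆Y t (sub-seg hs st) (D t st)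

  module _ {x y : Dir} where

    -- For X closed and x ≠ y, Down x y X is biclosed: closed since a subsegment of
    -- p ∘ q straddling the joint is a composite of subsegments of p and q; co-closed
    -- since p ∘ q keeps the subsegments of p or of q, whichever the joint step allows.
    down-closed : ∀ {X} → Closed λ' X → Closed λ' (down x y X)
    down-closed {X} closedX p q d hp hq joint p∈D q∈D = Down→down in-X
      where
      in-X : Down x y X (compose p q d)
      in-X t st with sub-of-composite joint st
      ... | inLeft  tp = down→Down p∈D t tp
      ... | inRight tq = down→Down q∈D t tq
      ... | across t₁p t₂q joint₁₂ refl =
        closedX _ _ d (sub-seg hp t₁p) (sub-seg hq t₂q) joint₁₂ (down→Down p∈D _ t₁p) (down→Down q∈D _ t₂q)

    down-coclosed : ∀ {X} → ¬ x ≡ y → Closed λ' (compl (down x y X))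
    down-coclosed {X} x≢y p q d _ _ joint p∉D q∉D = ¬→T-not λ pq∈D → case (dir-cases x≢y d) (down→Down pq∈D)
      where
      case : d ≡ x ⊎ d ≡ y → Down x y X (compose p q d) → ⊥
      case (inj₁ d≡x) D = T-not→¬ q∉D (Down→down λ t tq → D t (sub-right joint d≡x tq))
      case (inj₂ d≡y) D = T-not→¬ p∉D (Down→down λ t tp → D t (sub-left {q = q} d≡y tp))

    down-biclosed : ∀ {X} → ¬ x ≡ y → Closed λ' X → Biclosed λ' (down x y X)
    down-biclosed x≢y closedX = down-closed closedX , down-coclosed x≢y

    Shorter : SegSet → Seg → Set
    Shorter A s = ∃[ u ] Sub y x u s × T (A u) × length (steps u) < length (steps s)

    cut-before : ∀ {A} → Closed λ' (compl A) → ∀ p pre mid post → LastIs x pre →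
      IsSeg λ' (seg p (pre ++ mid ++ post)) → T (A (seg p (pre ++ mid))) → ¬ T (A (seg (walk p pre) mid)) →
      Shorter A (seg p (pre ++ mid ++ post))
    cut-before {A} closedAᶜ p pre mid post l hs P∈A t∉A with initLast pre
    ... | [] = ⊥-elim (t∉A P∈A)
    ... | pre′ ∷ʳ′ c with last-snoc pre′ c l
    ...   | refl with co-split closedAᶜ pre′ x mid (++-assoc pre′ [ x ] mid)
                      (isSeg-prefix p (pre ++ mid) post (sym (++-assoc pre mid post)) hs) P∈A
    ...     | inj₁ a∈A = seg p pre′ , prefix-sub pre′ (mid ++ post) (++-assoc pre′ [ x ] (mid ++ post)) , a∈A ,
                         shorter-prefix pre′ x (mid ++ post) (++-assoc pre′ [ x ] (mid ++ post))
    ...     | inj₂ t∈A = ⊥-elim (t∉A (subst (λ q → T (A (seg q mid))) (sym (walk-++ p pre′ [ x ])) t∈A))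

    shorten : ∀ {A s} → Closed λ' (compl A) → IsSeg λ' s → T (A s) → Bad x y A s → Shorter A s
    shorten {A} {seg p _} closedAᶜ hs s∈A (_ , sub pre mid [] refl l _ refl , t∉A) =
      cut-before closedAᶜ p pre mid [] l hs (subst (λ ds → T (A (seg p (pre ++ ds)))) (++-identityʳ mid) s∈A) t∉A
    shorten {A} {seg p _} closedAᶜ hs s∈A (_ , sub pre mid (_ ∷ post) refl l refl refl , t∉A)
      with T? (A (seg p (pre ++ mid)))
    ... | yes P∈A = cut-before closedAᶜ p pre mid (y ∷ post) l hs P∈A t∉A
    ... | no P∉A with co-split closedAᶜ (pre ++ mid) y post (sym (++-assoc pre mid (y ∷ post))) hs s∈A
    ...   | inj₁ P∈A = ⊥-elim (P∉A P∈A)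
    ...   | inj₂ Q∈A = _ , suffix-sub (pre ++ mid) post (sym (++-assoc pre mid (y ∷ post))) , Q∈A ,
                       shorter-suffix (pre ++ mid) y post (sym (++-assoc pre mid (y ∷ post)))

    descend : ∀ {A s} → Closed λ' (compl A) → IsSeg λ' s → T (A s) → ∃[ u ] Sub y x u s × Down x y A u
    descend {A} {s} closedAᶜ = go s (<-wellFounded (length (steps s)))
      where
      go : ∀ r → Acc _<_ (length (steps r)) → IsSeg λ' r → T (A r) → ∃[ u ] Sub y x u r × Down x y A u
      go r (acc shorter) hr r∈A with bad? x y A r
      ... | no ¬bad = r , sub-refl , ¬bad→Down ¬bad
      ... | yes bad with shorten closedAᶜ hr r∈A bad
      ...   | u , ru , u∈A , u<r with go u (shorter u<r) (sub-seg hr ru) u∈A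
      ...     | v , uv , Dv = v , sub-trans ru uv , Dv

  _↓⊆_ : SegSet → SegSet → Set
  X ↓⊆ Y = ∀ s → IsSeg λ' s → InDown λ' X s → InDown λ' Y s

  join-half : ∀ {X Y Z J₁ J₂} → Closed λ' (compl X) → X ↓⊆ Y → IsJoin λ' X Z J₁ → IsJoin λ' Y Z J₂ → J₁ ↓⊆ J₂
  join-half {X} {_} {Z} {J₁} {J₂} closedXᶜ X↓⊆Y↓ (_ , _ , _ , J₁-least) (J₂-biclosed , Y⊆J₂ , Z⊆J₂ , _) s hs s∈J₁↓ =
    Down→inDown in-J₂
    where
    -- The segments having some (E,S)-subsegment in J₂; a biclosed set.
    U : SegSet
    U = compl (down E S (compl J₂))

    meets-J₂ : ∀ {r u} → Sub E S u r → T (J₂ u) → T (U r)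
    meets-J₂ ru u∈J₂ = ¬→T-not λ r∈D → T-not→¬ (down→Down r∈D _ ru) u∈J₂

    X⊆U : X ⊆[ λ' ] U
    X⊆U r hr r∈X with descend {x = S} {y = E} {A = X} closedXᶜ hr r∈X
    ... | u , ru , Du = meets-J₂ ru (Y⊆J₂ u (sub-seg hr ru) (proj₁ (X↓⊆Y↓ u (sub-seg hr ru) (Down→inDown Du))))

    Z⊆U : Z ⊆[ λ' ] U
    Z⊆U r hr r∈Z = meets-J₂ sub-refl (Z⊆J₂ r hr r∈Z)

    J₁⊆U : J₁ ⊆[ λ' ] U
    J₁⊆U = J₁-least U (biclosed-compl {λ'} (down-biclosed (λ ()) (proj₂ J₂-biclosed))) X⊆U Z⊆U

    -- A SW-subsegment t ∉ J₂ of s would contain a SW-subsegment u ∈ Down E S (compl J₂),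
    -- i.e. u ∉ U, although u ∈ J₁ since s ∈ J₁↓.
    in-J₂ : Down S E J₂ s
    in-J₂ t st with T? (J₂ t)
    ... | yes t∈J₂ = t∈J₂
    ... | no t∉J₂ with descend {x = E} {y = S} {A = compl J₂}
                         (proj₂ (biclosed-compl {λ'} J₂-biclosed)) (sub-seg hs st) (¬→T-not t∉J₂)
    ...   | u , tu , Du =
      ⊥-elim (T-not→¬ (J₁⊆U u (sub-seg hs (sub-trans st tu)) (inDown→Down s∈J₁↓ u (sub-trans st tu))) (Down→down Du))

  -- Meets: X↓ ⊆ Y↓ gives (X ∧ Z)↓ ⊆ (Y ∧ Z)↓, since M₁↓ is a biclosed set below Y and Z.
  meet-half : ∀ {X Y Z M₁ M₂} → X ↓⊆ Y → IsMeet λ' X Z M₁ → IsMeet λ' Y Z M₂ → M₁ ↓⊆ M₂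
  meet-half {_} {Y} {Z} {M₁} {M₂} X↓⊆Y↓ (M₁-biclosed , M₁⊆X , M₁⊆Z , _) (_ , _ , _ , M₂-greatest) s hs s∈M₁↓ =
    Down→inDown λ t st → M₁↓⊆M₂ t (sub-seg hs st) (Down→down (down-hereditary (inDown→Down s∈M₁↓) st))
    where
    M₁↓⊆Y : down S E M₁ ⊆[ λ' ] Y
    M₁↓⊆Y r hr r∈M₁↓ = proj₁ (X↓⊆Y↓ r hr (Down→inDown (down-mono M₁⊆X hr (down→Down r∈M₁↓))))

    M₁↓⊆Z : down S E M₁ ⊆[ λ' ] Z
    M₁↓⊆Z r hr r∈M₁↓ = M₁⊆Z r hr (down→Down r∈M₁↓ r sub-refl)

    M₁↓⊆M₂ : down S E M₁ ⊆[ λ' ] M₂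
    M₁↓⊆M₂ = M₂-greatest (down S E M₁) (down-biclosed (λ ()) (proj₁ M₁-biclosed)) M₁↓⊆Y M₁↓⊆Z

theorem7p5 : (λ' : Shape) → IsLatticeCongruence λ' (DownEq λ')
theorem7p5 λ' =
  (λ _ _ s _ → id , id) ,
  (λ _ _ _ _ X≡Y s hs → swap (X≡Y s hs)) ,
  (λ _ _ _ _ _ _ X≡Y Y≡Z s hs → proj₁ (Y≡Z s hs) ∘ proj₁ (X≡Y s hs) , proj₂ (X≡Y s hs) ∘ proj₂ (Y≡Z s hs)) ,
  (λ _ _ _ _ _ (_ , closedXᶜ) (_ , closedYᶜ) _ X≡Y join₁ join₂ s hs →
     join-half λ' closedXᶜ (λ r hr → proj₁ (X≡Y r hr)) join₁ join₂ s hs ,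
     join-half λ' closedYᶜ (λ r hr → proj₂ (X≡Y r hr)) join₂ join₁ s hs) ,
  (λ _ _ _ _ _ _ _ _ X≡Y meet₁ meet₂ s hs →
     meet-half λ' (λ r hr → proj₁ (X≡Y r hr)) meet₁ meet₂ s hs ,
     meet-half λ' (λ r hr → proj₂ (X≡Y r hr)) meet₂ meet₁ s hs)
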